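{- Let $p\geq 1$, let $t\in\{4p-1,4p\}$, let $s=t+1$, and for $i\in\mathbb{Z}$ let $B_i=\{is,is+1,\ldots,(i+1)s-1\}$. Let $m$ be a positive integer with $m<t$. Let $P=(c_0,\ldots,c_{s-1})$ and $P'=(c'_0,\ldots,c'_{s-1})$ be two color patterns (sequences of positive integers of length $s$) such that each of them is a packing coloring of the cycle on $\mathbb{Z}_s$ (i.e. if $x\neq y$ and $c_x=c_y=c$ then $\min(|x-y|,s-|x-y|)>c$, and likewise for $P'$), such that every color occurring in both $P$ and $P'$ is at most $m$, and such that every color $c$ occurring in both $P$ and $P'$ occupies the same set of positions in $P$ and in $P'$ (i.e. $\{x: c_x=c\}=\{x:c'_x=c\}$). Let $i,j\in\mathbb{Z}$ with $|j-i|>\frac{m}{2}$, and color vertex $is+x$ with $c_x$ and vertex $js+x$ with $c'_x$ for $0\leq x<s$. Then for any $u\in B_i$ and $v\in B_j$ having the same color $c$, the distance between $u$ and $v$ in $D(1,t)$ is greater than $c$ (so placing $P$ on $B_i$ and $P'$ on $B_j$ creates no conflict between these two blocks).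
   Context: $D(1,t)$ denotes the distance graph $G(\mathbb{Z},\{1,t\})$: vertex set $\mathbb{Z}$, two distinct integers adjacent iff their difference in absolute value is $1$ or $t$; distances are graph distances in $D(1,t)$. A packing coloring requires two vertices of color $c$ to be at distance at least $c+1$. -}

module Defs where

open import Data.Nat as ℕ using (ℕ; suc; _∸_; _≤_; _<_)
open import Data.Integer as ℤ using (ℤ; +_; ∣_∣)
open import Data.Fin using (Fin; toℕ)
open import Data.Product using (∃; _×_)
open import Data.Sum using (_⊎_)
open import Relation.Binary.PropositionalEquality using (_≡_; _≢_)
open import Relation.Nullary using (¬_)

Adj : ℕ → ℤ → ℤ → Set
Adj t u v = u ≢ v × (∣ u ℤ.- v ∣ ≡ 1 ⊎ ∣ u ℤ.- v ∣ ≡ t)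

data Walk (t : ℕ) : ℕ → ℤ → ℤ → Set where
  here : ∀ {u} → Walk t 0 u u
  step : ∀ {n u w v} → Adj t u w → Walk t n w v → Walk t (suc n) u v

DistLE : ℕ → ℤ → ℤ → ℕ → Set
DistLE t u v c = ∃ λ n → n ≤ c × Walk t n u v

DistGT : ℕ → ℤ → ℤ → ℕ → Set
DistGT t u v c = ¬ DistLE t u v c

absDiff : ℕ → ℕ → ℕ
absDiff x y = ∣ + x ℤ.- + y ∣

cycDist : (s : ℕ) → Fin s → Fin s → ℕ
cycDist s x y = ℕ._⊓_ (absDiff (toℕ x) (toℕ y)) (s ∸ absDiff (toℕ x) (toℕ y))

IsCyclePacking : (s : ℕ) → (Fin s → ℕ) → Set
IsCyclePacking s P = ∀ x y → x ≢ y → P x ≡ P y → P x < cycDist s x y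

blockVertex : (s : ℕ) → ℤ → Fin s → ℤ
blockVertex s i x = i ℤ.* + s ℤ.+ + toℕ x

module Submission where

-- Every edge of D(1,t) changes a vertex by ±1 or ±t, so a walk of
-- length n from u to v yields integers a, b with v - u = a·t + b and
-- |a| + |b| ≤ n.  Writing u = i·s + x and v = j·s + y with s = t + 1, this
-- rearranges to a - b = q·s + (x - y) where q = a - (j - i).  Since
-- |a - b| ≤ |a| + |b| ≤ n, we get:
--   * q = 0, x = y : then a = b = j - i, so n ≥ 2|j - i|;
--   * q = 0, x ≠ y : then n ≥ |x - y|;
--   * q ≠ 0        : then n ≥ s - |x - y|.
-- Hence a walk between B_i and B_j at the same offset has length at least
-- min(2|j - i|, s), and between different offsets at least the cycle distance
-- of x and y in ℤ_s (lemma block-walk-bound).  The theorem follows: the common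
-- colour c satisfies c ≤ m < 2|j - i| and c ≤ m < t < s, and if x ≠ y then
-- c < cycDist x y because P is a packing of the cycle and P y = P x.

open import Defs
open import Data.Nat using (ℕ; suc; _*_; _∸_; _≤_; _<_)
open import Data.Integer as ℤ using (ℤ; ∣_∣)
open import Data.Fin using (Fin)
open import Data.Sum using (_⊎_)
open import Function.Bundles using (_⇔_)
open import Relation.Binary.PropositionalEquality using (_≡_)

open import Data.Nat as ℕ using (z≤n; s≤s)
import Data.Nat.Properties as NP
import Data.Integer.Properties as ZP
open import Data.Integer using (+_; -[1+_])
open import Data.Fin using (toℕ)
open import Data.Fin.Properties using (_≟_)
open import Data.Product using (∃₂; _×_; _,_)
open import Data.Sum using (inj₁; inj₂; map)
open import Function using (_∘_)
open import Function.Bundles using (Equivalence)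
open import Relation.Binary.PropositionalEquality
  using (_≢_; refl; sym; trans; cong; cong₂; subst; module ≡-Reasoning)
open import Relation.Nullary using (Dec; yes; no)
open import Data.Integer.Tactic.RingSolver using (solve-∀)
import Data.Nat.Tactic.RingSolver as ℕSolver

Reachable : ℕ → ℕ → ℤ → Set
Reachable t n d = ∃₂ λ a b → d ≡ a ℤ.* + t ℤ.+ b × ∣ a ∣ ℕ.+ ∣ b ∣ ≤ n

reachable-zero : ∀ t → Reachable t 0 (+ 0)
reachable-zero t = + 0 , + 0 , refl , z≤n

reachable-one : ∀ {t d} → ∣ d ∣ ≡ 1 ⊎ ∣ d ∣ ≡ t → Reachable t 1 d
reachable-one {d = d} (inj₁ ∣d∣≡1) =
  + 0 , d , sym (ZP.+-identityˡ d) , NP.≤-reflexive ∣d∣≡1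
reachable-one {d = + n} (inj₂ refl) = + 1 , + 0 , plusT (+ n) , s≤s z≤n
  where
  plusT : ∀ T → T ≡ + 1 ℤ.* T ℤ.+ + 0
  plusT = solve-∀
reachable-one {d = -[1+ n ]} (inj₂ refl) = ℤ.- + 1 , + 0 , minusT (+ suc n) , s≤s z≤n
  where
  minusT : ∀ T → ℤ.- T ≡ ℤ.- + 1 ℤ.* T ℤ.+ + 0
  minusT = solve-∀

reachable-+ : ∀ {t n k d e} → Reachable t n d → Reachable t k e → Reachable t (n ℕ.+ k) (d ℤ.+ e)
reachable-+ {t} {n} {k} (a , b , refl , ab≤n) (a′ , b′ , refl , a′b′≤k) =
  a ℤ.+ a′ , b ℤ.+ b′ , collect a b a′ b′ (+ t) , bound
  where
  collect : ∀ a b a′ b′ T → (a ℤ.* T ℤ.+ b) ℤ.+ (a′ ℤ.* T ℤ.+ b′) ≡ (a ℤ.+ a′) ℤ.* T ℤ.+ (b ℤ.+ b′)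
  collect = solve-∀
  regroup : ∀ p q r s → (p ℕ.+ q) ℕ.+ (r ℕ.+ s) ≡ (p ℕ.+ r) ℕ.+ (q ℕ.+ s)
  regroup = ℕSolver.solve-∀
  open NP.≤-Reasoning
  bound : ∣ a ℤ.+ a′ ∣ ℕ.+ ∣ b ℤ.+ b′ ∣ ≤ n ℕ.+ k
  bound = begin
    ∣ a ℤ.+ a′ ∣ ℕ.+ ∣ b ℤ.+ b′ ∣      ≤⟨ NP.+-mono-≤ (ZP.∣i+j∣≤∣i∣+∣j∣ a a′) (ZP.∣i+j∣≤∣i∣+∣j∣ b b′) ⟩
    (∣ a ∣ ℕ.+ ∣ a′ ∣) ℕ.+ (∣ b ∣ ℕ.+ ∣ b′ ∣) ≡⟨ regroup (∣ a ∣) (∣ a′ ∣) (∣ b ∣) (∣ b′ ∣) ⟩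
    (∣ a ∣ ℕ.+ ∣ b ∣) ℕ.+ (∣ a′ ∣ ℕ.+ ∣ b′ ∣) ≤⟨ NP.+-mono-≤ ab≤n a′b′≤k ⟩
    n ℕ.+ k                                ∎

adj-reachable : ∀ {t u w} → Adj t u w → Reachable t 1 (w ℤ.- u)
adj-reachable {u = u} {w} (_ , size) =
  reachable-one (map (trans flip) (trans flip) size)
  where
  flip : ∣ w ℤ.- u ∣ ≡ ∣ u ℤ.- w ∣
  flip = ZP.∣i-j∣≡∣j-i∣ w u

walk-reachable : ∀ {t n u v} → Walk t n u v → Reachable t n (v ℤ.- u)
walk-reachable {t} {u = u} here = subst (Reachable t 0) (sym (ZP.+-inverseʳ u)) (reachable-zero t)
walk-reachable {t} {suc n} {u} {v} (step {w = w} adj walk) =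
  subst (Reachable t (suc n)) (telescope u w v) (reachable-+ (adj-reachable adj) (walk-reachable walk))
  where
  telescope : ∀ u w v → (w ℤ.- u) ℤ.+ (v ℤ.- w) ≡ v ℤ.- u
  telescope = solve-∀

block-offsets : ∀ t a b i j (x y : Fin (suc t)) →
  blockVertex (suc t) j y ℤ.- blockVertex (suc t) i x ≡ a ℤ.* + t ℤ.+ b →
  a ℤ.- b ≡ (a ℤ.- (j ℤ.- i)) ℤ.* + suc t ℤ.+ (+ toℕ x ℤ.- + toℕ y)
block-offsets t a b i j x y eq = begin
  a ℤ.- b                                                ≡⟨ isolate a b (+ t) ⟩
  a ℤ.* + suc t ℤ.- (a ℤ.* + t ℤ.+ b)                    ≡⟨ cong (ℤ._-_ (a ℤ.* + suc t)) (sym eq) ⟩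
  a ℤ.* + suc t ℤ.- (blockVertex (suc t) j y ℤ.- blockVertex (suc t) i x)
                                                         ≡⟨ regroup a i j (+ toℕ x) (+ toℕ y) (+ t) ⟩
  (a ℤ.- (j ℤ.- i)) ℤ.* + suc t ℤ.+ (+ toℕ x ℤ.- + toℕ y) ∎
  where
  open ≡-Reasoning
  isolate : ∀ a b T → a ℤ.- b ≡ a ℤ.* (+ 1 ℤ.+ T) ℤ.- (a ℤ.* T ℤ.+ b)
  isolate = solve-∀
  regroup : ∀ a i j X Y T →
    a ℤ.* (+ 1 ℤ.+ T) ℤ.- ((j ℤ.* (+ 1 ℤ.+ T) ℤ.+ Y) ℤ.- (i ℤ.* (+ 1 ℤ.+ T) ℤ.+ X))
      ≡ (a ℤ.- (j ℤ.- i)) ℤ.* (+ 1 ℤ.+ T) ℤ.+ (X ℤ.- Y)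
  regroup = solve-∀

nonzero-multiple-bound : ∀ s q e → q ≢ + 0 → s ∸ ∣ e ∣ ≤ ∣ q ℤ.* + s ℤ.+ e ∣
nonzero-multiple-bound s q e q≢0 = NP.m≤n+o⇒m∸n≤o s (∣ e ∣) (begin
  s                                  ≤⟨ NP.m≤n*m s (∣ q ∣) {{ℕ.≢-nonZero (q≢0 ∘ ZP.∣i∣≡0⇒i≡0)}} ⟩
  ∣ q ∣ ℕ.* s                        ≡⟨ sym (ZP.∣i*j∣≡∣i∣*∣j∣ q (+ s)) ⟩
  ∣ q ℤ.* + s ∣                      ≡⟨ sym (ZP.∣-i∣≡∣i∣ (q ℤ.* + s)) ⟩
  ∣ ℤ.- (q ℤ.* + s) ∣                ≡⟨ cong ∣_∣ (cancel (q ℤ.* + s) e) ⟩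
  ∣ e ℤ.- (q ℤ.* + s ℤ.+ e) ∣        ≤⟨ ZP.∣i-j∣≤∣i∣+∣j∣ e _ ⟩
  ∣ e ∣ ℕ.+ ∣ q ℤ.* + s ℤ.+ e ∣      ∎)
  where
  open NP.≤-Reasoning
  cancel : ∀ Q e → ℤ.- Q ≡ e ℤ.- (Q ℤ.+ e)
  cancel = solve-∀

block-walk-bound : ∀ {t n} i j (x y : Fin (suc t)) →
  Walk t n (blockVertex (suc t) i x) (blockVertex (suc t) j y) →
  (2 * ∣ j ℤ.- i ∣ ≤ n ⊎ suc t ≤ n) ⊎ (x ≢ y × cycDist (suc t) x y ≤ n)
block-walk-bound {t} {n} i j x y walk with walk-reachable walk
... | a , b , eq , ab≤n = by-cases (a ℤ.- (j ℤ.- i) ZP.≟ + 0) (x ≟ y)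
  where
  q e : ℤ
  q = a ℤ.- (j ℤ.- i)
  e = + toℕ x ℤ.- + toℕ y
  offsets : a ℤ.- b ≡ q ℤ.* + suc t ℤ.+ e
  offsets = block-offsets t a b i j x y eq
  ∣a-b∣≤n : ∣ a ℤ.- b ∣ ≤ n
  ∣a-b∣≤n = NP.≤-trans (ZP.∣i-j∣≤∣i∣+∣j∣ a b) ab≤n
  aligned : q ≡ + 0 → a ℤ.- b ≡ e
  aligned q≡0 = trans offsets (trans (cong (λ r → r ℤ.* + suc t ℤ.+ e) q≡0) (ZP.+-identityˡ e))
  wrap≤n : q ≢ + 0 → suc t ∸ ∣ e ∣ ≤ n
  wrap≤n q≢0 = NP.≤-trans (nonzero-multiple-bound (suc t) q e q≢0) (subst (_≤ n) (cong ∣_∣ offsets) ∣a-b∣≤n)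
  e≡0 : x ≡ y → e ≡ + 0
  e≡0 x≡y = trans (cong (λ z → + toℕ x ℤ.- + toℕ z) (sym x≡y)) (ZP.+-inverseʳ (+ toℕ x))
  by-cases : Dec (q ≡ + 0) → Dec (x ≡ y) → (2 * ∣ j ℤ.- i ∣ ≤ n ⊎ suc t ≤ n) ⊎ (x ≢ y × cycDist (suc t) x y ≤ n)
  by-cases (yes q≡0) (yes x≡y) = inj₁ (inj₁ (NP.≤-trans (NP.≤-reflexive twice) ab≤n))
    where
    a≡j-i : a ≡ j ℤ.- i
    a≡j-i = ZP.i-j≡0⇒i≡j a (j ℤ.- i) q≡0
    a≡b : a ≡ b
    a≡b = ZP.i-j≡0⇒i≡j a b (trans (aligned q≡0) (e≡0 x≡y))
    twice : 2 * ∣ j ℤ.- i ∣ ≡ ∣ a ∣ ℕ.+ ∣ b ∣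
    twice = begin
      ∣ j ℤ.- i ∣ ℕ.+ (∣ j ℤ.- i ∣ ℕ.+ 0) ≡⟨ cong (∣ j ℤ.- i ∣ ℕ.+_) (NP.+-identityʳ _) ⟩
      ∣ j ℤ.- i ∣ ℕ.+ ∣ j ℤ.- i ∣         ≡⟨ cong₂ (λ u v → ∣ u ∣ ℕ.+ ∣ v ∣) (sym a≡j-i) (trans (sym a≡j-i) a≡b) ⟩
      ∣ a ∣ ℕ.+ ∣ b ∣                     ∎
      where open ≡-Reasoning
  by-cases (yes q≡0) (no x≢y) =
    inj₂ (x≢y , NP.≤-trans (NP.m⊓n≤m _ _) (subst (_≤ n) (cong ∣_∣ (aligned q≡0)) ∣a-b∣≤n))
  by-cases (no q≢0) (yes x≡y) =
    inj₁ (inj₂ (subst (λ k → suc t ∸ k ≤ n) (cong ∣_∣ (e≡0 x≡y)) (wrap≤n q≢0)))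
  by-cases (no q≢0) (no x≢y) = inj₂ (x≢y , NP.≤-trans (NP.m⊓n≤n _ _) (wrap≤n q≢0))

lemma2 : (p t m : ℕ) → 1 ≤ p → (t ≡ 4 * p ∸ 1 ⊎ t ≡ 4 * p) →
    1 ≤ m → m < t →
    (P P′ : Fin (suc t) → ℕ) →
    (∀ x → 1 ≤ P x) → (∀ x → 1 ≤ P′ x) →
    IsCyclePacking (suc t) P → IsCyclePacking (suc t) P′ →
    (∀ x y → P x ≡ P′ y → P x ≤ m) →
    (∀ x y → P x ≡ P′ y → ∀ z → (P z ≡ P x ⇔ P′ z ≡ P x)) →
    (i j : ℤ) → m < 2 * ∣ j ℤ.- i ∣ →
    (x y : Fin (suc t)) → P x ≡ P′ y →
    DistGT t (blockVertex (suc t) i x) (blockVertex (suc t) j y) (P x)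
lemma2 p t m _ _ _ m<t P P′ _ _ packing _ sharedSmall sameClass i j far x y Px≡P′y (n , n≤c , walk) =
  NP.<⇒≱ (colour<length (block-walk-bound i j x y walk)) n≤c
  where
  c≤m : P x ≤ m
  c≤m = sharedSmall x y Px≡P′y
  -- Position y carries colour P x in P, since the class of P x is the same in P and P′.
  Px≡Py : P x ≡ P y
  Px≡Py = sym (Equivalence.from (sameClass x y Px≡P′y y) (sym Px≡P′y))
  colour<length : (2 * ∣ j ℤ.- i ∣ ≤ n ⊎ suc t ≤ n) ⊎ (x ≢ y × cycDist (suc t) x y ≤ n) → P x < n
  colour<length (inj₁ (inj₁ 2∣j-i∣≤n)) = NP.<-≤-trans (NP.≤-<-trans c≤m far) 2∣j-i∣≤n
  colour<length (inj₁ (inj₂ s≤n))      = NP.<-≤-trans (s≤s (NP.≤-trans c≤m (NP.<⇒≤ m<t))) s≤n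
  colour<length (inj₂ (x≢y , cyc≤n))   = NP.<-≤-trans (packing x y x≢y Px≡Py) cyc≤n
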